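{- For any signature $S$, any set $X$ of positive integers, and any word $w$ on $S$ of length $n\in\mathbb N$: (i) in the $X$-tilted $S_{\mathbb N}$-easterly wind poset, $\mathbf f^{\uparrow}(w)\preceq\mathbf f^{\downarrow}(w)$; (ii) $\mathbf f^{\uparrow}(w)$ is a minimal element and $\mathbf f^{\downarrow}(w)$ is a maximal element of the $X$-tilted $S_{\mathbb N}$-easterly wind poset.
   Context: A signature is a set $S$ with an arity map $|\cdot|:S\to\mathbb N$. An $S$-term is either the leaf $\ell$ or $s\,t_1\cdots t_{|s|}$ with $s\in S$ and $S$-terms $t_i$; $T(S)$ is the set of $S$-terms. Preorder traversal: root, then subterms left to right recursively. Internal nodes are numbered $1,\dots,\deg t$ in preorder; $\mathrm{dc}(t)$ is the word of their decorations. Children (leaves included) are numbered from $1$ left to right; the parent edge of internal node $i$ is $(\mathrm{pa}(i),\mathrm{lp}(i),i)$ with $i$ the $\mathrm{lp}(i)$-th child of $\mathrm{pa}(i)$, and $\mathrm{pa}(1)=1,\mathrm{lp}(1)=0$. Connection word: $\mathrm{cnc}(t)(i)=\mathrm{pa}(i)+1-2^{\mathrm{lp}(i)-a}$, $a$ the arity of the decoration of $\mathrm{pa}(i)$. Easterly wind order: $t_1\preceq t_2$ iff $\mathrm{dc}(t_1)=\mathrm{dc}(t_2)$ and $\mathrm{cnc}(t_1)\le\mathrm{cnc}(t_2)$ componentwise. For a set $X$ of positive integers, $\mathrm{tlt}(X)(t)$ is obtained by rearranging, for each internal node $i\in X$, the children of $i$ so that non-leaf children keep their relative order and precede the leaf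 children; $t$ is $X$-tilted if $\mathrm{tlt}(X)(t)=t$, and the $X$-tilted $S$-easterly wind poset is the set of $X$-tilted $S$-terms ordered by $\preceq$. $S_{\mathbb N}=S\sqcup\mathbb N$, where $n\in\mathbb N$ has arity $n$. For $s$ in a signature, the corolla $c(s)$ is $s\,\ell\cdots\ell$ (one internal node, $|s|$ leaves). For an $S_{\mathbb N}$-term $F$ with at least one leaf and a term $u$, $F\bullet u$ is obtained by replacing the leftmost leaf of $F$ by $u$. For $w=w_1\cdots w_n$: $\mathbf f^{\uparrow}(w):=n\,c(w_1)\cdots c(w_n)$ and $\mathbf f^{\downarrow}(w):=(\cdots((c(n)\bullet c(w_1))\bullet c(w_2))\cdots)\bullet c(w_n)$, where $c(n)$ is the corolla of $n\in\mathbb N$ (for $n=0$ both are the term $0$). -}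

module Defs where

open import Data.Nat as ℕ using (ℕ; zero; suc; _+_; _∸_; _^_)
open import Data.Nat.Properties using (m^n≢0)
open import Data.Integer using (ℤ; +_)
open import Data.Rational as ℚ using (ℚ; _/_)
open import Data.Bool using (Bool; true; false; if_then_else_)
open import Data.List as List using (List; []; _∷_; _++_; length; foldl)
open import Data.List.Relation.Binary.Pointwise using (Pointwise)
open import Data.Vec as Vec using (Vec; []; _∷_; _∷ʳ_; replicate; fromList)
open import Data.Maybe using (Maybe; just; nothing; fromMaybe)
import Data.Maybe as Maybe
open import Data.Product using (_×_; _,_; proj₁; proj₂)
open import Data.Sum using (_⊎_; inj₁; inj₂; [_,_])
open import Function using (id)
open import Relation.Binary.PropositionalEquality using (_≡_)

data Term {A : Set} (ar : A → ℕ) : Set where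
  leaf : Term ar
  node : (s : A) → Vec (Term ar) (ar s) → Term ar

module _ {A : Set} {ar : A → ℕ} where

  isLeaf : Term ar → Bool
  isLeaf leaf       = true
  isLeaf (node _ _) = false

  mutual
    deg : Term ar → ℕ
    deg leaf        = 0
    deg (node s ts) = suc (degs ts)

    degs : ∀ {k} → Vec (Term ar) k → ℕ
    degs []       = 0
    degs (t ∷ ts) = deg t + degs ts

  -- connection value  pa + 1 - 2^(lp - a)  (with lp ≤ a), as a rational
  cval : (pa lp a : ℕ) → ℚ
  cval pa lp a = (+ suc pa / 1) ℚ.- (+ 1 / (2 ^ (a ∸ lp))) {{m^n≢0 2 (a ∸ lp)}}

  -- Preorder list of (decoration , cnc value) of internal nodes.
  -- nodesAt t i p l a : t is the l-th child of node p (decorated with arity a),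
  -- and the root of t (if internal) gets preorder number i.
  mutual
    nodesAt : Term ar → (i p l a : ℕ) → List (A × ℚ)
    nodesAt leaf        i p l a = []
    nodesAt (node s ts) i p l a = (s , cval p l a) ∷ childrenAt ts i (suc i) 1 (ar s)

    -- childrenAt ts p j pos a : children ts of node p (arity a), starting at
    -- child position pos, next free preorder number j.
    childrenAt : ∀ {k} → Vec (Term ar) k → (p j pos a : ℕ) → List (A × ℚ)
    childrenAt []       p j pos a = []
    childrenAt (t ∷ ts) p j pos a =
      nodesAt t j p pos a ++ childrenAt ts p (j + deg t) (suc pos) a

  -- the root is node 1 with pa(1) = 1, lp(1) = 0, a = arity of its own decoration
  entries : Term ar → List (A × ℚ)
  entries leaf        = []
  entries (node s ts) = nodesAt (node s ts) 1 1 0 (ar s)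

  dc : Term ar → List A
  dc t = List.map proj₁ (entries t)

  cnc : Term ar → List ℚ
  cnc t = List.map proj₂ (entries t)

  _⪯_ : Term ar → Term ar → Set
  t₁ ⪯ t₂ = (dc t₁ ≡ dc t₂) × Pointwise ℚ._≤_ (cnc t₁) (cnc t₂)

  tiltVec : ∀ {k} → Vec (Term ar) k → Vec (Term ar) k
  tiltVec []            = []
  tiltVec (leaf ∷ ts)   = tiltVec ts ∷ʳ leaf
  tiltVec (node s us ∷ ts) = node s us ∷ tiltVec ts

  mutual
    tltAt : (ℕ → Bool) → Term ar → ℕ → Term ar
    tltAt X leaf        i = leaf
    tltAt X (node s ts) i =
      node s (if X i then tiltVec (tltsAt X ts (suc i)) else tltsAt X ts (suc i))

    tltsAt : ∀ {k} → (ℕ → Bool) → Vec (Term ar) k → ℕ → Vec (Term ar) k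
    tltsAt X []       j = []
    tltsAt X (t ∷ ts) j = tltAt X t j ∷ tltsAt X ts (j + deg t)

  tlt : (ℕ → Bool) → Term ar → Term ar
  tlt X t = tltAt X t 1

  Tilted : (ℕ → Bool) → Term ar → Set
  Tilted X t = tlt X t ≡ t

  corolla : A → Term ar
  corolla s = node s (replicate (ar s) leaf)

  -- F • u : replace the leftmost leaf of F by u (F unchanged if it has no leaf;
  -- this case never arises below)
  mutual
    graftM : Term ar → Term ar → Maybe (Term ar)
    graftM leaf        u = just u
    graftM (node s ts) u = Maybe.map (node s) (graftsM ts u)

    graftsM : ∀ {k} → Vec (Term ar) k → Term ar → Maybe (Vec (Term ar) k)
    graftsM []       u = nothing
    graftsM (t ∷ ts) u with graftM t u
    ... | just t′ = just (t′ ∷ ts)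
    ... | nothing = Maybe.map (t ∷_) (graftsM ts u)

  _•_ : Term ar → Term ar → Term ar
  F • u = fromMaybe F (graftM F u)

SN : Set → Set
SN S = S ⊎ ℕ

arN : {S : Set} → (S → ℕ) → SN S → ℕ
arN ar = [ ar , id ]

module _ {S : Set} {ar : S → ℕ} where

  f↑ : List S → Term (arN ar)
  f↑ w = node (inj₂ (length w)) (Vec.map (λ s → corolla (inj₁ s)) (fromList w))

  f↓ : List S → Term (arN ar)
  f↓ w = foldl (λ F s → F • corolla (inj₁ s)) (corolla (inj₂ (length w))) w

module Submission where

-- A node whose parent is p has connection value in [p, p + 1), and among
-- siblings the value decreases strictly with the position.  So comparing cnc
-- entrywise compares parents first and then positions in reverse order.
--
-- The k-th non-root node of f↓ w is a child of the root at a position at most k,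
-- or lies deeper; either way its value is at least that of the k-th node of f↑ w,
-- whose nodes are the children of the root in order.  Conversely, every value of
-- a term below f↑ w is below 2, so all of its nodes hang off the root, and
-- counting nodes leaves no room for a leaf child.
--
-- Grafting always fills the leftmost leaf, so in preorder every internal node of
-- f↓ w comes before every leaf.  A term t above f↓ w can therefore never have a
-- leaf where f↓ w has an internal node: the next node of t would be a later
-- sibling or have an earlier parent, and its value would be too small.
--
-- In f↑ w and f↓ w the internal children of every node precede the leaves, so
-- both terms are fixed by every tilting.

open import Defs
open import Data.Nat as ℕ using (ℕ; zero; suc; _+_; _∸_; _^_; _≤_; _<_; s≤s; z≤n; NonZero)
import Data.Nat.Properties as ℕP
open import Data.Integer as ℤ using (+_)
import Data.Integer.Properties as ℤP
open import Data.Rational as ℚ using (ℚ; _/_; mkℚ; *≤*; *<*; 0ℚ; 1ℚ)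
import Data.Rational.Properties as ℚP
import Data.Rational.Unnormalised as ℚᵘ
import Data.Rational.Unnormalised.Properties as ℚᵘP
open import Data.Nat.Coprimality using (1-coprimeTo) renaming (sym to coprime-sym)
open import Algebra.Properties.Group ℚP.+-0-group using (//-rightDividesʳ)
open import Algebra.Properties.CommutativeSemigroup ℕP.+-commutativeSemigroup using (xy∙z≈xz∙y)
open import Data.Bool using (Bool; false; true)
open import Data.List using (List; []; _∷_; _++_; length; map; foldl)
import Data.List.Properties as ListP
open import Data.List.Relation.Binary.Pointwise as Pointwise using (Pointwise; []; _∷_)
open import Data.List.Relation.Unary.All using (All; []; _∷_)
import Data.List.Relation.Unary.All.Properties as AllP
open import Data.Vec as Vec using (Vec; []; _∷_; _∷ʳ_; replicate)
open import Data.Maybe as Maybe using (just; nothing)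
open import Data.Product using (∃; _×_; _,_; proj₁; proj₂)
open import Data.Sum using (inj₁; inj₂)
open import Data.Unit using (⊤; tt)
open import Data.Empty using (⊥; ⊥-elim)
open import Relation.Binary.PropositionalEquality
  using (_≡_; refl; sym; trans; cong; cong₂; subst; subst₂; module ≡-Reasoning)

Pointwise-[]ˡ : ∀ {B C : Set} {R : B → C → Set} {ys : List C} → Pointwise R [] ys → ys ≡ []
Pointwise-[]ˡ [] = refl

+-suc-≤ : ∀ {m n o} → m + suc n ≤ o → suc m + n ≤ o
+-suc-≤ {m} {n} {o} = subst (_≤ o) (ℕP.+-suc m n)

fromℕ : ℕ → ℚ
fromℕ n = + n / 1

fromℕ-mkℚ : ∀ n → fromℕ n ≡ mkℚ (+ n) 0 (coprime-sym (1-coprimeTo n))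
fromℕ-mkℚ n = ℚP.normalize-coprime _

fromℕ-mono-≤ : ∀ {m n} → m ≤ n → fromℕ m ℚ.≤ fromℕ n
fromℕ-mono-≤ {m} {n} m≤n rewrite fromℕ-mkℚ m | fromℕ-mkℚ n =
  *≤* (ℤP.*-monoʳ-≤-nonNeg (+ 1) (ℤ.+≤+ m≤n))

fromℕ-suc : ∀ n → fromℕ n ℚ.+ 1ℚ ≡ fromℕ (suc n)
fromℕ-suc n = ℚP.toℚᵘ-injective (ℚᵘP.≃-trans (ℚP.toℚᵘ-homo-+ (fromℕ n) 1ℚ) unnormalised)
  where
  unnormalised : ℚ.toℚᵘ (fromℕ n) ℚᵘ.+ ℚ.toℚᵘ 1ℚ ℚᵘ.≃ ℚ.toℚᵘ (fromℕ (suc n))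
  unnormalised rewrite fromℕ-mkℚ n | fromℕ-mkℚ (suc n) =
    ℚᵘ.*≡* (cong (ℤ._* + 1) (trans (cong (ℤ._+ + 1) (ℤP.*-identityʳ (+ n))) (ℤP.+-comm (+ n) (+ 1))))

fromℕ-suc-1 : ∀ n → fromℕ (suc n) ℚ.- 1ℚ ≡ fromℕ n
fromℕ-suc-1 n = trans (cong (ℚ._- 1ℚ) (sym (fromℕ-suc n))) (//-rightDividesʳ 1ℚ (fromℕ n))

recip-mkℚ : ∀ k → + 1 / suc k ≡ mkℚ (+ 1) k (1-coprimeTo (suc k))
recip-mkℚ k = ℚP.normalize-coprime (1-coprimeTo (suc k))

recip-pos : ∀ d .{{_ : NonZero d}} → 0ℚ ℚ.< + 1 / d
recip-pos d = ℚP.positive⁻¹ (+ 1 / d) {{ℚP.normalize-pos 1 d}}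

recip-antitone-≤ : ∀ {d d′} .{{_ : NonZero d}} .{{_ : NonZero d′}} → d ≤ d′ → + 1 / d′ ℚ.≤ + 1 / d
recip-antitone-≤ {suc k} {suc k′} d≤d′ rewrite recip-mkℚ k | recip-mkℚ k′ =
  *≤* (ℤ.+≤+ (ℕP.+-monoˡ-≤ 0 d≤d′))

recip-antitone-< : ∀ {d d′} .{{_ : NonZero d}} .{{_ : NonZero d′}} → d < d′ → + 1 / d′ ℚ.< + 1 / d
recip-antitone-< {suc k} {suc k′} d<d′ rewrite recip-mkℚ k | recip-mkℚ k′ =
  *<* (ℤ.+<+ (ℕP.+-monoˡ-< 0 d<d′))

half^ : ℕ → ℚ
half^ m = (+ 1 / 2 ^ m) {{ℕP.m^n≢0 2 m}}

half^-pos : ∀ m → 0ℚ ℚ.< half^ m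
half^-pos m = recip-pos (2 ^ m) {{ℕP.m^n≢0 2 m}}

half^≤1 : ∀ m → half^ m ℚ.≤ 1ℚ
half^≤1 m = recip-antitone-≤ {{_}} {{ℕP.m^n≢0 2 m}} (ℕP.m^n>0 2 m)

half^-antitone-≤ : ∀ {m m′} → m ≤ m′ → half^ m′ ℚ.≤ half^ m
half^-antitone-≤ {m} {m′} m≤m′ =
  recip-antitone-≤ {{ℕP.m^n≢0 2 m}} {{ℕP.m^n≢0 2 m′}} (ℕP.^-monoʳ-≤ 2 m≤m′)

half^-antitone-< : ∀ {m m′} → m < m′ → half^ m′ ℚ.< half^ m
half^-antitone-< {m} {m′} m<m′ =
  recip-antitone-< {{ℕP.m^n≢0 2 m}} {{ℕP.m^n≢0 2 m′}} (ℕP.^-monoʳ-< 2 (s≤s (s≤s z≤n)) m<m′)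

module Terms {A : Set} {ar : A → ℕ} where

  cval-upper : ∀ p l a → cval {A} {ar} p l a ℚ.< fromℕ (suc p)
  cval-upper p l a = subst (cval {A} {ar} p l a ℚ.<_) (ℚP.+-identityʳ (fromℕ (suc p)))
    (ℚP.+-monoʳ-< (fromℕ (suc p)) (ℚP.neg-antimono-< (half^-pos (a ∸ l))))

  cval-lower : ∀ p l a → fromℕ p ℚ.≤ cval {A} {ar} p l a
  cval-lower p l a = subst (ℚ._≤ cval {A} {ar} p l a) (fromℕ-suc-1 p)
    (ℚP.+-monoʳ-≤ (fromℕ (suc p)) (ℚP.neg-antimono-≤ (half^≤1 (a ∸ l))))

  cval-antitone : ∀ p {l l′} a → l ≤ l′ → cval {A} {ar} p l′ a ℚ.≤ cval {A} {ar} p l a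
  cval-antitone p a l≤l′ = ℚP.+-monoʳ-≤ (fromℕ (suc p))
    (ℚP.neg-antimono-≤ (half^-antitone-≤ (ℕP.∸-monoʳ-≤ a l≤l′)))

  -- l′ ≤ a matters: beyond a the truncated a ∸ l′ stays 0.
  cval-strictlyAntitone : ∀ p {l l′} a → l < l′ → l′ ≤ a → cval {A} {ar} p l′ a ℚ.< cval {A} {ar} p l a
  cval-strictlyAntitone p a l<l′ l′≤a = ℚP.+-monoʳ-< (fromℕ (suc p))
    (ℚP.neg-antimono-< (half^-antitone-< (ℕP.∸-monoʳ-< l<l′ l′≤a)))

  leaves : ∀ k → Vec (Term ar) k
  leaves k = replicate k leaf

  mutual
    preorder : Term ar → List A
    preorder leaf        = []
    preorder (node s ts) = s ∷ preorders ts

    preorders : ∀ {k} → Vec (Term ar) k → List A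
    preorders []       = []
    preorders (t ∷ ts) = preorder t ++ preorders ts

  mutual
    leafCount : Term ar → ℕ
    leafCount leaf        = 1
    leafCount (node _ ts) = leafCounts ts

    leafCounts : ∀ {k} → Vec (Term ar) k → ℕ
    leafCounts []       = 0
    leafCounts (t ∷ ts) = leafCount t + leafCounts ts

  preorders-leaves : ∀ k → preorders (leaves k) ≡ []
  preorders-leaves zero    = refl
  preorders-leaves (suc k) = preorders-leaves k

  leafCounts-leaves : ∀ k → leafCounts (leaves k) ≡ k
  leafCounts-leaves zero    = refl
  leafCounts-leaves (suc k) = cong suc (leafCounts-leaves k)

  childrenAt-leaves : ∀ k {p j pos a} → childrenAt (leaves k) p j pos a ≡ []
  childrenAt-leaves zero    = refl
  childrenAt-leaves (suc k) = childrenAt-leaves k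

  childrenAt≡[]⇒leaves : ∀ {k} (ts : Vec (Term ar) k) {p j pos a} →
                         childrenAt ts p j pos a ≡ [] → ts ≡ leaves k
  childrenAt≡[]⇒leaves []              _  = refl
  childrenAt≡[]⇒leaves (leaf ∷ ts)     eq = cong (leaf ∷_) (childrenAt≡[]⇒leaves ts eq)
  childrenAt≡[]⇒leaves (node _ _ ∷ ts) ()

  mutual
    dc-nodesAt : ∀ t {i p l a} → map proj₁ (nodesAt t i p l a) ≡ preorder t
    dc-nodesAt leaf        = refl
    dc-nodesAt (node s ts) = cong (s ∷_) (dc-childrenAt ts)

    dc-childrenAt : ∀ {k} (ts : Vec (Term ar) k) {p j pos a} →
                    map proj₁ (childrenAt ts p j pos a) ≡ preorders ts
    dc-childrenAt []                          = refl
    dc-childrenAt (t ∷ ts) {p} {j} {pos} {a} =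
      trans (ListP.map-++ proj₁ (nodesAt t j p pos a) _) (cong₂ _++_ (dc-nodesAt t) (dc-childrenAt ts))

  CncAtLeast : ℚ → List (A × ℚ) → Set
  CncAtLeast c = All (λ e → c ℚ.≤ proj₂ e)

  CncBelow : ℚ → List (A × ℚ) → Set
  CncBelow c = All (λ e → proj₂ e ℚ.< c)

  CncAtLeast∧CncBelow⇒[] : ∀ {c c′ es} → c′ ℚ.≤ c → CncAtLeast c es → CncBelow c′ es → es ≡ []
  CncAtLeast∧CncBelow⇒[] c′≤c []           _            = refl
  CncAtLeast∧CncBelow⇒[] c′≤c (c≤e ∷ _)    (e<c′ ∷ _) =
    ⊥-elim (ℚP.<-irrefl refl (ℚP.<-≤-trans (ℚP.≤-<-trans c≤e e<c′) c′≤c))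

  mutual
    cnc-nodesAt-≥ : ∀ t {i p l a q} → q ≤ p → q ≤ i → CncAtLeast (fromℕ q) (nodesAt t i p l a)
    cnc-nodesAt-≥ leaf        q≤p q≤i = []
    cnc-nodesAt-≥ (node s ts) {i} {p} {l} {a} q≤p q≤i =
      ℚP.≤-trans (fromℕ-mono-≤ q≤p) (cval-lower p l a) ∷ cnc-childrenAt-≥ ts q≤i (ℕP.m≤n⇒m≤1+n q≤i)

    cnc-childrenAt-≥ : ∀ {k} (ts : Vec (Term ar) k) {p j pos a q} → q ≤ p → q ≤ j →
                       CncAtLeast (fromℕ q) (childrenAt ts p j pos a)
    cnc-childrenAt-≥ []       q≤p q≤j = []
    cnc-childrenAt-≥ (t ∷ ts) {j = j} q≤p q≤j =
      AllP.++⁺ (cnc-nodesAt-≥ t q≤p q≤j) (cnc-childrenAt-≥ ts q≤p (ℕP.≤-trans q≤j (ℕP.m≤m+n j (deg t))))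

  cnc-childrenOf-≥ : ∀ {b} (us : Vec (Term ar) b) j → CncAtLeast (fromℕ j) (childrenAt us j (suc j) 1 b)
  cnc-childrenOf-≥ us j = cnc-childrenAt-≥ us ℕP.≤-refl (ℕP.n≤1+n j)

  -- The shape of f↓: in preorder every internal node comes before every leaf,
  -- i.e. once a child has a leaf below it, all later siblings are leaves.
  mutual
    LeavesLast : ∀ {k} → Vec (Term ar) k → Set
    LeavesLast []               = ⊤
    LeavesLast (leaf ∷ ts)      = ts ≡ leaves _
    LeavesLast (node _ cs ∷ ts) = LeavesLast cs × LeavesLastAfter (leafCounts cs) ts

    LeavesLastAfter : ℕ → ∀ {k} → Vec (Term ar) k → Set
    LeavesLastAfter zero    ts = LeavesLast ts
    LeavesLastAfter (suc _) ts = ts ≡ leaves _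

  leaves-LeavesLast : ∀ k → LeavesLast (leaves k)
  leaves-LeavesLast zero    = tt
  leaves-LeavesLast (suc k) = refl

  leaves-LeavesLastAfter : ∀ n k → LeavesLastAfter n (leaves k)
  leaves-LeavesLastAfter zero    k = leaves-LeavesLast k
  leaves-LeavesLastAfter (suc n) k = refl

  LeavesLastAfter⇒LeavesLast : ∀ n {k} {ts : Vec (Term ar) k} → LeavesLastAfter n ts → LeavesLast ts
  LeavesLastAfter⇒LeavesLast zero    ll   = ll
  LeavesLastAfter⇒LeavesLast (suc n) refl = leaves-LeavesLast _

  mutual
    graftM-leafless : ∀ t u → leafCount t ≡ 0 → graftM t u ≡ nothing
    graftM-leafless (node s ts) u eq rewrite graftsM-leafless ts u eq = refl

    graftsM-leafless : ∀ {k} (ts : Vec (Term ar) k) u → leafCounts ts ≡ 0 → graftsM ts u ≡ nothing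
    graftsM-leafless []       u eq = refl
    graftsM-leafless (t ∷ ts) u eq
      rewrite graftM-leafless t u (ℕP.m+n≡0⇒m≡0 (leafCount t) eq)
            | graftsM-leafless ts u (ℕP.m+n≡0⇒n≡0 (leafCount t) eq) = refl

  graftsM-here : ∀ {k t t′ u} (ts : Vec (Term ar) k) → graftM t u ≡ just t′ → graftsM (t ∷ ts) u ≡ just (t′ ∷ ts)
  graftsM-here _ eq rewrite eq = refl

  graftsM-there : ∀ {k t u} {ts ts′ : Vec (Term ar) k} →
                  graftM t u ≡ nothing → graftsM ts u ≡ just ts′ → graftsM (t ∷ ts) u ≡ just (t ∷ ts′)
  graftsM-there eq eq′ rewrite eq | eq′ = refl

  record GraftedCorolla {k} (F : Vec (Term ar) k) (s : A) (m : ℕ) : Set where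
    constructor grafted
    field
      result      : Vec (Term ar) k
      graftsM≡    : graftsM F (corolla s) ≡ just result
      leavesLast  : LeavesLast result
      leafCounts≡ : leafCounts result ≡ m + ar s
      preorders≡  : preorders result ≡ preorders F ++ s ∷ []

  graftCorolla : ∀ {k} (F : Vec (Term ar) k) s {m} → LeavesLast F → leafCounts F ≡ suc m → GraftedCorolla F s m
  graftCorolla {suc k} (leaf ∷ _) s {m} refl count =
    grafted (corolla s ∷ leaves k) refl
      (leaves-LeavesLast (ar s) , leaves-LeavesLastAfter (leafCounts (leaves (ar s))) k) leafCounts≡ preorders≡
    where
    leafCounts≡ : leafCounts (leaves (ar s)) + leafCounts (leaves k) ≡ m + ar s
    leafCounts≡ rewrite leafCounts-leaves (ar s) | leafCounts-leaves k =
      trans (ℕP.+-comm (ar s) k) (cong (_+ ar s) (ℕP.suc-injective count))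
    preorders≡ : s ∷ preorders (leaves (ar s)) ++ preorders (leaves k) ≡ preorders (leaves k) ++ s ∷ []
    preorders≡ rewrite preorders-leaves (ar s) | preorders-leaves k = refl
  graftCorolla {suc k} (node s₀ cs ∷ F′) s {m} (ll-cs , ll-F′) count with leafCounts cs in cs-count
  ... | zero =
    grafted (node s₀ cs ∷ F″)
      (graftsM-there (graftM-leafless (node s₀ cs) (corolla s) cs-count) graft-eq)
      (ll-cs , subst (λ n → LeavesLastAfter n F″) (sym cs-count) ll-F″)
      (trans (cong (_+ leafCounts F″) cs-count) count-F″)
      (cong (s₀ ∷_) (trans (cong (preorders cs ++_) pre-F″) (sym (ListP.++-assoc (preorders cs) (preorders F′) _))))
    where open GraftedCorolla (graftCorolla F′ s ll-F′ count)
            renaming (result to F″; graftsM≡ to graft-eq; leavesLast to ll-F″;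
                      leafCounts≡ to count-F″; preorders≡ to pre-F″)
  ... | suc m₀ with refl ← ll-F′ =
    grafted (node s₀ cs′ ∷ leaves k)
      (graftsM-here {t = node s₀ cs} (leaves k) (cong (Maybe.map (node s₀)) graft-eq))
      (ll-cs′ , leaves-LeavesLastAfter (leafCounts cs′) k) leafCounts≡ preorders≡
    where
    open GraftedCorolla (graftCorolla cs s ll-cs cs-count)
      renaming (result to cs′; graftsM≡ to graft-eq; leavesLast to ll-cs′;
                leafCounts≡ to count-cs′; preorders≡ to pre-cs′)
    open ≡-Reasoning
    leafCounts≡ : leafCounts cs′ + leafCounts (leaves k) ≡ m + ar s
    leafCounts≡ = begin
      leafCounts cs′ + leafCounts (leaves k) ≡⟨ cong₂ _+_ count-cs′ (leafCounts-leaves k) ⟩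
      m₀ + ar s + k                          ≡⟨ xy∙z≈xz∙y m₀ (ar s) k ⟩
      m₀ + k + ar s                          ≡⟨ cong (_+ ar s) m₀+k≡m ⟩
      m + ar s                               ∎
      where
      m₀+k≡m : m₀ + k ≡ m
      m₀+k≡m = ℕP.suc-injective (trans (cong (suc m₀ ℕ.+_) (sym (leafCounts-leaves k))) count)
    preorders≡ : s₀ ∷ preorders cs′ ++ preorders (leaves k) ≡ (s₀ ∷ preorders cs ++ preorders (leaves k)) ++ s ∷ []
    preorders≡ rewrite preorders-leaves k | ListP.++-identityʳ (preorders cs′) | ListP.++-identityʳ (preorders cs) =
      cong (s₀ ∷_) pre-cs′

  GraftedCorollas : ∀ {B : Set} (f : B → A) r (F : Vec (Term ar) (ar r)) (w : List B) → Set
  GraftedCorollas f r F w = ∃ λ F′ → foldl (λ G s → G • corolla (f s)) (node r F) w ≡ node r F′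
                              × LeavesLast F′ × preorders F′ ≡ preorders F ++ map f w

  graftCorollas : ∀ {B : Set} (f : B → A) r (F : Vec (Term ar) (ar r)) (w : List B) →
                  LeavesLast F → length w ≤ leafCounts F → GraftedCorollas f r F w
  graftCorollas f r F []      ll _ = F , refl , ll , sym (ListP.++-identityʳ (preorders F))
  graftCorollas f r F (s ∷ w) ll enough with leafCounts F in count
  ... | suc m = continue (graftCorolla F (f s) ll count)
    where
    continue : GraftedCorolla F (f s) m → GraftedCorollas f r F (s ∷ w)
    continue (grafted F₁ graft-eq ll-F₁ count-F₁ pre-F₁)
      with F′ , fold-eq , ll-F′ , pre-F′ ← graftCorollas f r F₁ w ll-F₁
             (ℕP.≤-trans (ℕP.≤-pred enough) (ℕP.≤-trans (ℕP.m≤m+n m (ar (f s))) (ℕP.≤-reflexive (sym count-F₁))))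
      = F′ , trans (cong (λ G → foldl (λ G s → G • corolla (f s)) G w) graft-step) fold-eq , ll-F′ ,
        trans pre-F′ (trans (cong (_++ map f w) pre-F₁) (ListP.++-assoc (preorders F) (f s ∷ []) (map f w)))
      where
      graft-step : node r F • corolla (f s) ≡ node r F₁
      graft-step rewrite graft-eq = refl

  mutual
    TiltedEverywhere : Term ar → Set
    TiltedEverywhere leaf        = ⊤
    TiltedEverywhere (node _ ts) = AllTiltedEverywhere ts × tiltVec ts ≡ ts

    AllTiltedEverywhere : ∀ {k} → Vec (Term ar) k → Set
    AllTiltedEverywhere []       = ⊤
    AllTiltedEverywhere (t ∷ ts) = TiltedEverywhere t × AllTiltedEverywhere ts

  mutual
    tltAt-TiltedEverywhere : ∀ X t i → TiltedEverywhere t → tltAt X t i ≡ t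
    tltAt-TiltedEverywhere X leaf        i _ = refl
    tltAt-TiltedEverywhere X (node s ts) i (tilted-ts , tilt≡)
      rewrite tltsAt-AllTiltedEverywhere X ts (suc i) tilted-ts with X i
    ... | true  = cong (node s) tilt≡
    ... | false = refl

    tltsAt-AllTiltedEverywhere : ∀ X {k} (ts : Vec (Term ar) k) j → AllTiltedEverywhere ts → tltsAt X ts j ≡ ts
    tltsAt-AllTiltedEverywhere X []       j _ = refl
    tltsAt-AllTiltedEverywhere X (t ∷ ts) j (tilted-t , tilted-ts) =
      cong₂ _∷_ (tltAt-TiltedEverywhere X t j tilted-t) (tltsAt-AllTiltedEverywhere X ts (j + deg t) tilted-ts)

  TiltedEverywhere⇒Tilted : ∀ X {t} → TiltedEverywhere t → Tilted X t
  TiltedEverywhere⇒Tilted X {t} = tltAt-TiltedEverywhere X t 1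

  tiltVec-leaves : ∀ k → tiltVec (leaves k) ≡ leaves k
  tiltVec-leaves zero    = refl
  tiltVec-leaves (suc k) rewrite tiltVec-leaves k = leaves-∷ʳ k
    where
    leaves-∷ʳ : ∀ k → leaves k ∷ʳ leaf ≡ leaf ∷ leaves k
    leaves-∷ʳ zero    = refl
    leaves-∷ʳ (suc k) = cong (leaf ∷_) (leaves-∷ʳ k)

  leaves-AllTiltedEverywhere : ∀ k → AllTiltedEverywhere (leaves k)
  leaves-AllTiltedEverywhere zero    = tt
  leaves-AllTiltedEverywhere (suc k) = tt , leaves-AllTiltedEverywhere k

  corolla-TiltedEverywhere : ∀ s → TiltedEverywhere (corolla s)
  corolla-TiltedEverywhere s = leaves-AllTiltedEverywhere (ar s) , tiltVec-leaves (ar s)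

  LeavesLast⇒tiltVec≡ : ∀ {k} (F : Vec (Term ar) k) → LeavesLast F → tiltVec F ≡ F
  LeavesLast⇒tiltVec≡ []              _           = refl
  LeavesLast⇒tiltVec≡ (leaf ∷ _)      refl        = tiltVec-leaves (suc _)
  LeavesLast⇒tiltVec≡ (node s cs ∷ F) (_ , after) =
    cong (node s cs ∷_) (LeavesLast⇒tiltVec≡ F (LeavesLastAfter⇒LeavesLast (leafCounts cs) after))

  LeavesLast⇒AllTiltedEverywhere : ∀ {k} (F : Vec (Term ar) k) → LeavesLast F → AllTiltedEverywhere F
  LeavesLast⇒AllTiltedEverywhere []              _             = tt
  LeavesLast⇒AllTiltedEverywhere (leaf ∷ _)      refl          = leaves-AllTiltedEverywhere (suc _)
  LeavesLast⇒AllTiltedEverywhere (node s cs ∷ F) (ll-cs , after) =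
    (LeavesLast⇒AllTiltedEverywhere cs ll-cs , LeavesLast⇒tiltVec≡ cs ll-cs) ,
    LeavesLast⇒AllTiltedEverywhere F (LeavesLastAfter⇒LeavesLast (leafCounts cs) after)

  corollasOf : ∀ {B : Set} → (B → A) → (u : List B) → Vec (Term ar) (length u)
  corollasOf f u = Vec.map (λ s → corolla (f s)) (Vec.fromList u)

  preorders-corollasOf : ∀ {B : Set} (f : B → A) u → preorders (corollasOf f u) ≡ map f u
  preorders-corollasOf f []      = refl
  preorders-corollasOf f (s ∷ u) rewrite preorders-leaves (ar (f s)) = cong (f s ∷_) (preorders-corollasOf f u)

  corollasOf-AllTiltedEverywhere : ∀ {B : Set} (f : B → A) u → AllTiltedEverywhere (corollasOf f u)
  corollasOf-AllTiltedEverywhere f []      = tt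
  corollasOf-AllTiltedEverywhere f (s ∷ u) = corolla-TiltedEverywhere (f s) , corollasOf-AllTiltedEverywhere f u

  tiltVec-corollasOf : ∀ {B : Set} (f : B → A) u → tiltVec (corollasOf f u) ≡ corollasOf f u
  tiltVec-corollasOf f []      = refl
  tiltVec-corollasOf f (s ∷ u) = cong (corolla (f s) ∷_) (tiltVec-corollasOf f u)

  cvals : (p pos a m : ℕ) → List ℚ
  cvals p pos a zero    = []
  cvals p pos a (suc m) = cval {A} {ar} p pos a ∷ cvals p (suc pos) a m

  cvals-++ : ∀ p pos a m n → cvals p pos a (m + n) ≡ cvals p pos a m ++ cvals p (pos + m) a n
  cvals-++ p pos a zero    n rewrite ℕP.+-identityʳ pos = refl
  cvals-++ p pos a (suc m) n rewrite ℕP.+-suc pos m = cong (cval {A} {ar} p pos a ∷_) (cvals-++ p (suc pos) a m n)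

  cvals-below : ∀ p pos a m → All (ℚ._< fromℕ (suc p)) (cvals p pos a m)
  cvals-below p pos a zero    = []
  cvals-below p pos a (suc m) = cval-upper p pos a ∷ cvals-below p (suc pos) a m

  cnc-corollasOf : ∀ {B : Set} (f : B → A) u {p j pos a} →
                   map proj₂ (childrenAt (corollasOf f u) p j pos a) ≡ cvals p pos a (length u)
  cnc-corollasOf f []      = refl
  cnc-corollasOf f (s ∷ u) {p} {j} {pos} {a} rewrite childrenAt-leaves (ar (f s)) {j} {suc j} {1} {ar (f s)} =
    cong (cval {A} {ar} p pos a ∷_) (cnc-corollasOf f u)

  cvals≤cnc : ∀ {p} es pos a → CncAtLeast (fromℕ (suc p)) es →
              Pointwise ℚ._≤_ (cvals p pos a (length es)) (map proj₂ es)
  cvals≤cnc []       pos a []             = []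
  cvals≤cnc {p} (_ ∷ es) pos a (above ∷ rest) =
    ℚP.<⇒≤ (ℚP.<-≤-trans (cval-upper p pos a) above) ∷ cvals≤cnc es (suc pos) a rest

  cvals≤cnc-LeavesLast : ∀ {k} (F : Vec (Term ar) k) {p j pos a} q → LeavesLast F → p < j → pos ≤ q →
                         Pointwise ℚ._≤_ (cvals p q a (length (childrenAt F p j pos a)))
                                          (map proj₂ (childrenAt F p j pos a))
  cvals≤cnc-LeavesLast []              q _    _   _     = []
  cvals≤cnc-LeavesLast {suc k} (leaf ∷ _) {p} {j} {pos} {a} q refl _ _
    rewrite childrenAt-leaves k {p} {j + 0} {suc pos} {a} = []
  cvals≤cnc-LeavesLast (node s cs ∷ F) {p} {j} {pos} {a} q (_ , after) p<j pos≤q =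
    cval-antitone p a pos≤q ∷
    subst₂ (Pointwise ℚ._≤_) (sym split) (sym (ListP.map-++ proj₂ D E))
      (Pointwise.++⁺ (cvals≤cnc D (suc q) a (cnc-childrenAt-≥ cs p<j (ℕP.m≤n⇒m≤1+n p<j)))
                     (cvals≤cnc-LeavesLast F (suc q + length D) (LeavesLastAfter⇒LeavesLast (leafCounts cs) after)
                        (ℕP.<-≤-trans p<j (ℕP.m≤m+n j _)) (s≤s (ℕP.≤-trans pos≤q (ℕP.m≤m+n q _)))))
    where
    D = childrenAt cs j (suc j) 1 (ar s)
    E = childrenAt F p (j + deg (node s cs)) (suc pos) a
    split : cvals p (suc q) a (length (D ++ E))
          ≡ cvals p (suc q) a (length D) ++ cvals p (suc q + length D) a (length E)
    split rewrite ListP.length-++ D {E} = cvals-++ p (suc q) a (length D) (length E)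

  _≤ₑ_ : A × ℚ → A × ℚ → Set
  e ≤ₑ e′ = proj₁ e ≡ proj₁ e′ × proj₂ e ℚ.≤ proj₂ e′

  ≡∧≤⇒Pointwise-≤ₑ : ∀ es es′ → map proj₁ es ≡ map proj₁ es′ → Pointwise ℚ._≤_ (map proj₂ es) (map proj₂ es′) →
               Pointwise _≤ₑ_ es es′
  ≡∧≤⇒Pointwise-≤ₑ []       []         _  []            = []
  ≡∧≤⇒Pointwise-≤ₑ (_ ∷ es) (_ ∷ es′) dc (c≤c′ ∷ cnc) =
    (ListP.∷-injectiveˡ dc , c≤c′) ∷ ≡∧≤⇒Pointwise-≤ₑ es es′ (ListP.∷-injectiveʳ dc) cnc

  ⪯⇒entries-≤ₑ : ∀ {t t′ : Term ar} → t ⪯ t′ → Pointwise _≤ₑ_ (entries t) (entries t′)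
  ⪯⇒entries-≤ₑ {t} {t′} (dc≡ , cnc≤) = ≡∧≤⇒Pointwise-≤ₑ (entries t) (entries t′) dc≡ cnc≤

  CncBelow-≤ₑ : ∀ {c es es′} → Pointwise _≤ₑ_ es es′ → CncBelow c es′ → CncBelow c es
  CncBelow-≤ₑ []               []         = []
  CncBelow-≤ₑ ((_ , e≤e′) ∷ le) (e′<c ∷ below) = ℚP.≤-<-trans e≤e′ e′<c ∷ CncBelow-≤ₑ le below

  childrenOf-below⇒[] : ∀ {b} (us : Vec (Term ar) b) {p} j → p < j →
                        CncBelow (fromℕ (suc p)) (childrenAt us j (suc j) 1 b) → childrenAt us j (suc j) 1 b ≡ []
  childrenOf-below⇒[] us j p<j = CncAtLeast∧CncBelow⇒[] (fromℕ-mono-≤ p<j) (cnc-childrenOf-≥ us j)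

  length-childrenAt-≤ : ∀ {k} (ts : Vec (Term ar) k) {p j pos a} → p < j →
                        CncBelow (fromℕ (suc p)) (childrenAt ts p j pos a) → length (childrenAt ts p j pos a) ≤ k
  length-childrenAt-≤ []              _   _ = z≤n
  length-childrenAt-≤ (leaf ∷ ts)     {j = j} p<j below =
    ℕP.m≤n⇒m≤1+n (length-childrenAt-≤ ts (ℕP.<-≤-trans p<j (ℕP.m≤m+n j 0)) below)
  length-childrenAt-≤ (node s us ∷ ts) {p} {j} {pos} {a} p<j (_ ∷ below)
    with below-D , below-E ← AllP.++⁻ (childrenAt us j (suc j) 1 (ar s)) below
    rewrite childrenOf-below⇒[] us j p<j below-D =
    s≤s (length-childrenAt-≤ ts (ℕP.<-≤-trans p<j (ℕP.m≤m+n j _)) below-E)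

  length-childrenAt-corollasOf : ∀ {B : Set} (f : B → A) u {p j pos a} →
                                 length (childrenAt (corollasOf f u) p j pos a) ≡ length u
  length-childrenAt-corollasOf f []      = refl
  length-childrenAt-corollasOf f (s ∷ u) {j = j} rewrite childrenAt-leaves (ar (f s)) {j} {suc j} {1} {ar (f s)} =
    cong suc (length-childrenAt-corollasOf f u)

  corollasOf-below : ∀ {B : Set} (f : B → A) u {p j pos a} →
                     CncBelow (fromℕ (suc p)) (childrenAt (corollasOf f u) p j pos a)
  corollasOf-below f u {p} {j} {pos} {a} =
    AllP.map⁻ (subst (All (ℚ._< fromℕ (suc p))) (sym (cnc-corollasOf f u)) (cvals-below p pos a (length u)))

  corollasOf-minimal : ∀ {B : Set} (f : B → A) u (ts : Vec (Term ar) (length u)) {p j pos a} → p < j →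
                       Pointwise _≤ₑ_ (childrenAt ts p j pos a) (childrenAt (corollasOf f u) p j pos a) →
                       ts ≡ corollasOf f u
  corollasOf-minimal f []      []          _   _  = refl
  corollasOf-minimal f (s ∷ u) (leaf ∷ ts) {p} {j} {pos} {a} p<j le =
    ⊥-elim (ℕP.<-irrefl refl (ℕP.≤-trans (ℕP.≤-reflexive too-long) fits))
    where
    E = childrenAt ts p (j + 0) (suc pos) a
    fits : length E ≤ length u
    fits = length-childrenAt-≤ ts (ℕP.<-≤-trans p<j (ℕP.m≤m+n j 0))
             (CncBelow-≤ₑ le (corollasOf-below f (s ∷ u)))
    too-long : suc (length u) ≡ length E
    too-long = sym (trans (Pointwise.Pointwise-length le) (length-childrenAt-corollasOf f (s ∷ u)))
  corollasOf-minimal f (s ∷ u) (node _ us ∷ ts) {p} {j} {pos} {a} p<j ((refl , _) ∷ le)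
    with _ ∷ below ← corollasOf-below f (s ∷ u) {p} {j} {pos} {a}
    with refl ← childrenAt≡[]⇒leaves us (childrenOf-below⇒[] us j p<j (AllP.++⁻ˡ _ (CncBelow-≤ₑ le below)))
    rewrite childrenAt-leaves (ar (f s)) {j} {suc j} {1} {ar (f s)} =
    cong (corolla (f s) ∷_) (corollasOf-minimal f u ts (ℕP.<-≤-trans p<j (ℕP.m≤m+n j _)) le)

  HeadBelow : ℚ → List (A × ℚ) → Set
  HeadBelow c []      = ⊤
  HeadBelow c (e ∷ _) = proj₂ e ℚ.< c

  HeadBelow-weaken : ∀ {c c′} R → c ℚ.≤ c′ → HeadBelow c R → HeadBelow c′ R
  HeadBelow-weaken []      _    _   = tt
  HeadBelow-weaken (_ ∷ _) c≤c′ e<c = ℚP.<-≤-trans e<c c≤c′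

  HeadBelow-childrenAt : ∀ {k} (ts : Vec (Term ar) k) {p j pos a c} R → pos + k ≤ suc a →
                         (∀ {q} → pos ≤ q → q ≤ a → cval {A} {ar} p q a ℚ.< c) →
                         HeadBelow c R → HeadBelow c (childrenAt ts p j pos a ++ R)
  HeadBelow-childrenAt []                          R _     _      hb = hb
  HeadBelow-childrenAt (leaf ∷ ts) R fits below hb =
    HeadBelow-childrenAt ts R (+-suc-≤ fits) (λ pos<q q≤a → below (ℕP.<⇒≤ pos<q) q≤a) hb
  HeadBelow-childrenAt {suc k} (node _ _ ∷ _) {pos = pos} R fits below _ =
    below ℕP.≤-refl (ℕP.≤-pred (ℕP.≤-trans (ℕP.m≤m+n (suc pos) k) (+-suc-≤ fits)))

  HeadBelow-refutes-≤ₑ : ∀ {e es es′} → Pointwise _≤ₑ_ (e ∷ es) es′ → HeadBelow (proj₂ e) es′ → ⊥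
  HeadBelow-refutes-≤ₑ ((_ , e≤e′) ∷ _) e′<e = ℚP.<-irrefl refl (ℚP.≤-<-trans e≤e′ e′<e)

  -- R₁ and R₂ are the entries that follow these children in t and in F.
  LeavesLast-maximal : ∀ {k} (F ts : Vec (Term ar) k) {p j pos a R₁ R₂} →
                       LeavesLast F → pos + k ≤ suc a → p < j → HeadBelow (fromℕ p) R₁ →
                       (∀ {m} → leafCounts F ≡ suc m → R₂ ≡ []) →
                       Pointwise _≤ₑ_ (childrenAt F p j pos a ++ R₂) (childrenAt ts p j pos a ++ R₁) →
                       ts ≡ F
  LeavesLast-maximal [] [] _ _ _ _ _ _ = refl
  LeavesLast-maximal {suc k} (leaf ∷ _) ts {p} {j} {pos} {a} {R₁} refl _ _ _ ends le
    with refl ← ends refl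
    rewrite childrenAt-leaves k {p} {j + 0} {suc pos} {a} =
    childrenAt≡[]⇒leaves ts (ListP.++-conicalˡ _ R₁ (Pointwise-[]ˡ le))
  LeavesLast-maximal {suc k} (node s cs ∷ F) (leaf ∷ ts) {p} {j} {pos} {a} {R₁} _ fits p<j hb _ le =
    ⊥-elim (HeadBelow-refutes-≤ₑ le
      (HeadBelow-childrenAt ts R₁ (+-suc-≤ fits)
        (λ pos<q q≤a → cval-strictlyAntitone p a pos<q q≤a)
        (HeadBelow-weaken R₁ (cval-lower p pos a) hb)))
  LeavesLast-maximal {suc k} (node s cs ∷ F) (node _ us ∷ ts) {p} {j} {pos} {a} {R₁} {R₂}
    (ll-cs , after) fits p<j hb ends ((refl , _) ∷ le) =
    siblings (LeavesLast-maximal cs us ll-cs ℕP.≤-refl (ℕP.n<1+n j) hb-siblings ends-cs le′)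
    where
    open ≡-Reasoning
    j′ = j + deg (node s cs)
    D  = childrenAt cs j (suc j) 1 (ar s)
    E  = childrenAt F p j′ (suc pos) a
    Dₜ = childrenAt us j (suc j) 1 (ar s)
    Eₜ = childrenAt ts p (j + deg (node s us)) (suc pos) a
    fits′ : suc pos + k ≤ suc a
    fits′ = +-suc-≤ fits
    le′ : Pointwise _≤ₑ_ (D ++ (E ++ R₂)) (Dₜ ++ (Eₜ ++ R₁))
    le′ = subst₂ (Pointwise _≤ₑ_) (ListP.++-assoc D E R₂) (ListP.++-assoc Dₜ Eₜ R₁) le
    hb-siblings : HeadBelow (fromℕ j) (Eₜ ++ R₁)
    hb-siblings = HeadBelow-childrenAt ts R₁ fits′
      (λ {q} _ _ → ℚP.<-≤-trans (cval-upper p q a) (fromℕ-mono-≤ p<j))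
      (HeadBelow-weaken R₁ (fromℕ-mono-≤ (ℕP.<⇒≤ p<j)) hb)
    ends-cs : ∀ {m} → leafCounts cs ≡ suc m → E ++ R₂ ≡ []
    ends-cs count = begin
      E ++ R₂                                      ≡⟨ cong₂ (λ G R → childrenAt G p j′ (suc pos) a ++ R)
                                                        (subst (λ n → LeavesLastAfter n F) count after)
                                                        (ends (cong (_+ leafCounts F) count)) ⟩
      childrenAt (leaves k) p j′ (suc pos) a ++ [] ≡⟨ ListP.++-identityʳ _ ⟩
      childrenAt (leaves k) p j′ (suc pos) a       ≡⟨ childrenAt-leaves k ⟩
      []                                           ∎
    ends-F : ∀ {m} → leafCounts F ≡ suc m → R₂ ≡ []
    ends-F {m} count = ends (trans (cong (leafCounts cs ℕ.+_) count) (ℕP.+-suc (leafCounts cs) m))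
    siblings : us ≡ cs → node s us ∷ ts ≡ node s cs ∷ F
    siblings refl = cong (node s cs ∷_)
      (LeavesLast-maximal F ts (LeavesLastAfter⇒LeavesLast (leafCounts cs) after) fits′
        (ℕP.<-≤-trans p<j (ℕP.m≤m+n j _)) hb ends-F (Pointwise.++-cancelˡ D le′))

module _ {S : Set} {ar : S → ℕ} where

  open Terms {SN S} {arN ar}

  f↓-shape : ∀ w → ∃ λ F → f↓ {ar = ar} w ≡ node (inj₂ (length w)) F × LeavesLast F × preorders F ≡ map inj₁ w
  f↓-shape w
    with F , f↓≡ , ll , pre ← graftCorollas inj₁ (inj₂ (length w)) (leaves (length w)) w
                                (leaves-LeavesLast _) (ℕP.≤-reflexive (sym (leafCounts-leaves _)))
    = F , f↓≡ , ll , trans pre (cong (_++ map inj₁ w) (preorders-leaves (length w)))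

  f↑⪯f↓ : ∀ w → f↑ {ar = ar} w ⪯ f↓ w
  f↑⪯f↓ w with F , f↓≡ , ll , pre ← f↓-shape w rewrite f↓≡ =
    cong (inj₂ n ∷_) (trans dc↑ (sym dc↓)) , ℚP.≤-refl ∷ cnc≤
    where
    n = length w
    E = childrenAt F 1 2 1 n
    dc↑ : map proj₁ (childrenAt (corollasOf inj₁ w) 1 2 1 n) ≡ map inj₁ w
    dc↑ = trans (dc-childrenAt (corollasOf inj₁ w)) (preorders-corollasOf inj₁ w)
    dc↓ : map proj₁ E ≡ map inj₁ w
    dc↓ = trans (dc-childrenAt F) pre
    length-E : length E ≡ n
    length-E = trans (sym (ListP.length-map proj₁ E)) (trans (cong length dc↓) (ListP.length-map inj₁ w))
    cnc≤ : Pointwise ℚ._≤_ (map proj₂ (childrenAt (corollasOf inj₁ w) 1 2 1 n)) (map proj₂ E)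
    cnc≤ rewrite cnc-corollasOf inj₁ w {1} {2} {1} {n} =
      subst (λ m → Pointwise ℚ._≤_ (cvals 1 1 n m) (map proj₂ E)) length-E
        (cvals≤cnc-LeavesLast F 1 ll (s≤s (s≤s z≤n)) ℕP.≤-refl)

  f↑-tilted : ∀ X w → Tilted X (f↑ {ar = ar} w)
  f↑-tilted X w = TiltedEverywhere⇒Tilted X (corollasOf-AllTiltedEverywhere inj₁ w , tiltVec-corollasOf inj₁ w)

  f↓-tilted : ∀ X w → Tilted X (f↓ {ar = ar} w)
  f↓-tilted X w with F , f↓≡ , ll , _ ← f↓-shape w rewrite f↓≡ =
    TiltedEverywhere⇒Tilted X (LeavesLast⇒AllTiltedEverywhere F ll , LeavesLast⇒tiltVec≡ F ll)

  f↑-minimal : ∀ w (t : Term (arN ar)) → t ⪯ f↑ w → t ≡ f↑ w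
  f↑-minimal w t t⪯f↑ = minimal t (⪯⇒entries-≤ₑ {t} {f↑ w} t⪯f↑)
    where
    minimal : ∀ t → Pointwise _≤ₑ_ (entries t) (entries (f↑ {ar = ar} w)) → t ≡ f↑ w
    minimal (node _ ts) ((refl , _) ∷ le) =
      cong (node (inj₂ (length w))) (corollasOf-minimal inj₁ w ts (s≤s (s≤s z≤n)) le)

  f↓-maximal : ∀ w (t : Term (arN ar)) → f↓ w ⪯ t → t ≡ f↓ w
  f↓-maximal w t f↓⪯t with F , f↓≡ , ll , _ ← f↓-shape w rewrite f↓≡ =
    maximal t (⪯⇒entries-≤ₑ {node (inj₂ (length w)) F} {t} f↓⪯t)
    where
    maximal : ∀ t → Pointwise _≤ₑ_ (entries (node (inj₂ (length w)) F)) (entries t) →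
              t ≡ node (inj₂ (length w)) F
    maximal (node _ ts) ((refl , _) ∷ le) =
      cong (node (inj₂ (length w)))
        (LeavesLast-maximal F ts ll ℕP.≤-refl (s≤s (s≤s z≤n)) tt (λ _ → refl)
          (subst₂ (Pointwise _≤ₑ_) (sym (ListP.++-identityʳ _)) (sym (ListP.++-identityʳ _)) le))

theorem4p1p1 : (S : Set) (ar : S → ℕ) (X : ℕ → Bool) → X zero ≡ false → (w : List S) →
    (f↑ {ar = ar} w ⪯ f↓ w)
    × ((Tilted X (f↑ {ar = ar} w) × (∀ (t : Term (arN ar)) → Tilted X t → t ⪯ f↑ w → t ≡ f↑ w))
    × (Tilted X (f↓ {ar = ar} w) × (∀ (t : Term (arN ar)) → Tilted X t → f↓ w ⪯ t → t ≡ f↓ w)))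
-- Minimality and maximality hold among all terms.
theorem4p1p1 S ar X _ w =
  f↑⪯f↓ w ,
  (f↑-tilted X w , λ t _ → f↑-minimal w t) ,
  (f↓-tilted X w , λ t _ → f↓-maximal w t)
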